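{- For all integers $n\geq 0$ and $k\in\mathbb{Z}$, \[ E_{n}^{(k)}=\sum_{m=0}^{n}\sum_{l=1}^{m+1}\binom{n}{m}\frac{2^{m}(-1)^{m+1+l}\,l!}{l^{k}(m+1)}\,S_{2}(m+1,l)\,E_{n-m}. \]
   Context: For $k\in\mathbb{Z}$, $\mathrm{Li}_k(z)=\sum_{n=1}^{\infty}\frac{z^n}{n^k}$. The poly-Euler polynomials $E_n^{(k)}(x)$ are defined by \[ \frac{\mathrm{Li}_{k}(1-e^{ -2t})}{t(e^{t}+1)}e^{xt}=\sum_{n=0}^{\infty}E_{n}^{(k)}(x)\frac{t^{n}}{n!}, \] and $E_n^{(k)}=E_n^{(k)}(0)$. The Euler numbers $E_n$ are defined by $\frac{2}{e^t+1}=\sum_{n\ge0}E_n\frac{t^n}{n!}$. The Stirling numbers of the second kind are defined by $\frac{1}{m!}(e^t-1)^m=\sum_{n=m}^{\infty}S_2(n,m)\frac{t^n}{n!}$. -}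

module Defs where

open import Data.Nat as ℕ using (ℕ; zero; suc)
open import Data.Nat.Properties using (m^n≢0; _!≢0)
open import Data.Nat.Combinatorics using (_C_)
open import Data.Integer as ℤ using (ℤ; +_; -[1+_])
open import Data.Rational using (ℚ; _/_; 0ℚ; 1ℚ; ½; _+_; _*_; -_; _-_)

ι : ℕ → ℚ
ι n = + n / 1

_^ℚ_ : ℚ → ℕ → ℚ
q ^ℚ zero  = 1ℚ
q ^ℚ suc n = q * (q ^ℚ n)

inv! : ℕ → ℚ
inv! n = _/_ (+ 1) (n ℕ.!) {{n !≢0}}

-- j ↦ 1 / j^k  for j = suc i ≥ 1 and k ∈ ℤ  (for k < 0 this is j^{-k})
invPow : ℕ → ℤ → ℚ
invPow i (+ n)     = _/_ (+ 1) (suc i ℕ.^ n) {{m^n≢0 (suc i) n}}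
invPow i -[1+ n ]  = ι (suc i ℕ.^ suc n)

sumTo : ℕ → (ℕ → ℚ) → ℚ
sumTo zero    f = f zero
sumTo (suc n) f = sumTo n f + f (suc n)

sum1To : ℕ → (ℕ → ℚ) → ℚ
sum1To zero    f = 0ℚ
sum1To (suc n) f = sum1To n f + f (suc n)

-- Formal power series over ℚ, given by their (ordinary) coefficients:
-- a series a represents  Σ_n a n · t^n.

Series : Set
Series = ℕ → ℚ

oneS : Series
oneS zero    = 1ℚ
oneS (suc n) = 0ℚ

_⊕_ : Series → Series → Series
(a ⊕ b) n = a n + b n

scaleS : ℚ → Series → Series
scaleS c a n = c * a n

_⊛_ : Series → Series → Series
(a ⊛ b) n = sumTo n (λ i → a i * b (n ℕ.∸ i))

powS : Series → ℕ → Series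
powS a zero    = oneS
powS a (suc m) = a ⊛ powS a m

expS : ℚ → Series
expS c n = (c ^ℚ n) * inv! n

-- Multiplicative inverse of a series a whose constant term a 0 has
-- inverse c (i.e. c = 1 / a 0):  b 0 = c,  b n = - c Σ_{i=1}^{n} a i b (n-i).
-- invList a c n = [b n, b (n-1), …, b 0].
open import Data.List using (List; []; _∷_)

private
  lookupL : List ℚ → ℕ → ℚ
  lookupL []       _       = 0ℚ
  lookupL (x ∷ xs) zero    = x
  lookupL (x ∷ xs) (suc i) = lookupL xs i

invList : Series → ℚ → ℕ → List ℚ
invList a c zero    = c ∷ []
invList a c (suc n) =
  let prev = invList a c n  -- prev = [b n, …, b 0]; b j = lookupL prev (n - j)
  in (- (c * sum1To (suc n) (λ i → a i * lookupL prev (i ℕ.∸ 1)))) ∷ prev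

invS : Series → ℚ → Series
invS a c n with invList a c n
... | []    = 0ℚ
... | x ∷ _ = x

-- Polylogarithm Li_k(u) = Σ_{j≥1} u^j / j^k, composed with a series u
-- with u 0 = 0 (so only j ≤ n contribute to the coefficient of t^n).
LiS : ℤ → Series → Series
LiS k u n = sum1To n (λ j → invPow (j ℕ.∸ 1) k * powS u j n)

divT : Series → Series
divT a n = a (suc n)

-- e^t + 1  (constant term 2)
expPlusOne : Series
expPlusOne = expS 1ℚ ⊕ oneS

invExpPlusOne : Series
invExpPlusOne = invS expPlusOne ½

oneMinusExpM2 : Series
oneMinusExpM2 = oneS ⊕ scaleS (- 1ℚ) (expS (- ι 2))

-- Euler numbers:  2/(e^t+1) = Σ E_n t^n / n!
euler : ℕ → ℚ
euler n = ι (n ℕ.!) * scaleS (ι 2) invExpPlusOne n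

-- Stirling numbers of the second kind:
-- (e^t - 1)^m / m! = Σ_{n≥m} S2(n,m) t^n / n!
S2 : ℕ → ℕ → ℚ
S2 n m = ι (n ℕ.!) * (inv! m * powS (expS 1ℚ ⊕ scaleS (- 1ℚ) oneS) m n)

-- Poly-Euler polynomials:
-- Li_k(1 - e^{-2t}) / (t (e^t + 1)) · e^{x t} = Σ E_n^{(k)}(x) t^n / n!
polyEulerPoly : ℕ → ℤ → ℚ → ℚ
polyEulerPoly n k x =
  ι (n ℕ.!) * ((divT (LiS k oneMinusExpM2) ⊛ invExpPlusOne) ⊛ expS x) n

polyEuler : ℕ → ℤ → ℚ
polyEuler n k = polyEulerPoly n k 0ℚ

sgn : ℕ → ℚ
sgn e = (- 1ℚ) ^ℚ e

invSuc : ℕ → ℚ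
invSuc m = + 1 / suc m

-- Compare coefficients. Since the summand j of Li_k(u) is u^j / j^k and
-- 1 - e^{-2t} is -(e^s - 1) with s = -2t, the coefficient of t^{m+1} in
-- (1 - e^{-2t})^l is (-1)^l (-2)^{m+1} l! S_2(m+1,l) / (m+1)!.  Multiplying by
-- the coefficient of t^{n-m} in 1/(e^t+1), i.e. E_{n-m} / (2 (n-m)!), and by n!,
-- the factorials recombine into binomial(n,m) / (m+1).
module Submission where

open import Defs
open import Data.Nat as ℕ using (ℕ; zero; suc; z≤n; _∸_; _!)
import Data.Nat.Properties as ℕₚ
open import Data.Nat.DivMod using (m/n*n≡m)
open import Data.Nat.Combinatorics using (_C_; nCk≡n!/k![n-k]!; k![n∸k]!∣n!)
open import Data.Integer as ℤ using (ℤ)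
import Data.Integer.Properties as ℤₚ
open import Data.Rational using (ℚ; 0ℚ; 1ℚ; _+_; _*_; -_; _/_; _≟_; toℚᵘ)
open import Data.Rational.Properties
import Data.Rational.Unnormalised as ℚᵘ
import Data.Rational.Unnormalised.Properties as ℚᵘₚ
open import Relation.Binary.PropositionalEquality
  using (_≡_; refl; sym; trans; cong; cong₂; module ≡-Reasoning)
open import Relation.Nullary.Decidable.Core using (dec⇒maybe)
open import Tactic.RingSolver.Core.AlmostCommutativeRing using (AlmostCommutativeRing; fromCommutativeRing)
open import Tactic.RingSolver using (solve-∀)

open ≡-Reasoning

ℚ-ring : AlmostCommutativeRing _ _
ℚ-ring = fromCommutativeRing +-*-commutativeRing (λ x → dec⇒maybe (0ℚ ≟ x))

sumTo-cong : ∀ n {f g : ℕ → ℚ} → (∀ i → i ℕ.≤ n → f i ≡ g i) → sumTo n f ≡ sumTo n g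
sumTo-cong zero    f≡g = f≡g 0 z≤n
sumTo-cong (suc n) f≡g =
  cong₂ _+_ (sumTo-cong n (λ i i≤n → f≡g i (ℕₚ.m≤n⇒m≤1+n i≤n))) (f≡g (suc n) ℕₚ.≤-refl)

sum1To-cong : ∀ n {f g : ℕ → ℚ} → (∀ i → f i ≡ g i) → sum1To n f ≡ sum1To n g
sum1To-cong zero    f≡g = refl
sum1To-cong (suc n) f≡g = cong₂ _+_ (sum1To-cong n f≡g) (f≡g (suc n))

sumTo-zero : ∀ n (f : ℕ → ℚ) → (∀ i → i ℕ.≤ n → f i ≡ 0ℚ) → sumTo n f ≡ 0ℚ
sumTo-zero n f f≡0 = trans (sumTo-cong n f≡0) (zeros n)
  where
  zeros : ∀ n → sumTo n (λ _ → 0ℚ) ≡ 0ℚ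
  zeros zero    = refl
  zeros (suc n) = trans (cong (_+ 0ℚ) (zeros n)) (+-identityʳ 0ℚ)

*-distribˡ-sumTo : ∀ n c (f : ℕ → ℚ) → c * sumTo n f ≡ sumTo n (λ i → c * f i)
*-distribˡ-sumTo zero    c f = refl
*-distribˡ-sumTo (suc n) c f =
  trans (*-distribˡ-+ c (sumTo n f) (f (suc n))) (cong (_+ c * f (suc n)) (*-distribˡ-sumTo n c f))

*-distribˡ-sum1To : ∀ n c (f : ℕ → ℚ) → c * sum1To n f ≡ sum1To n (λ i → c * f i)
*-distribˡ-sum1To zero    c f = *-zeroʳ c
*-distribˡ-sum1To (suc n) c f =
  trans (*-distribˡ-+ c (sum1To n f) (f (suc n))) (cong (_+ c * f (suc n)) (*-distribˡ-sum1To n c f))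

*-distribʳ-sum1To : ∀ n c (f : ℕ → ℚ) → sum1To n f * c ≡ sum1To n (λ i → f i * c)
*-distribʳ-sum1To zero    c f = *-zeroˡ c
*-distribʳ-sum1To (suc n) c f =
  trans (*-distribʳ-+ c (sum1To n f) (f (suc n))) (cong (_+ f (suc n) * c) (*-distribʳ-sum1To n c f))

^ℚ-distribˡ-+-* : ∀ c i j → c ^ℚ (i ℕ.+ j) ≡ c ^ℚ i * c ^ℚ j
^ℚ-distribˡ-+-* c zero    j = sym (*-identityˡ (c ^ℚ j))
^ℚ-distribˡ-+-* c (suc i) j =
  trans (cong (c *_) (^ℚ-distribˡ-+-* c i j)) (sym (*-assoc c (c ^ℚ i) (c ^ℚ j)))

^ℚ-zeroˡ : ∀ n → 1ℚ ^ℚ n ≡ 1ℚ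
^ℚ-zeroˡ zero    = refl
^ℚ-zeroˡ (suc n) = trans (*-identityˡ (1ℚ ^ℚ n)) (^ℚ-zeroˡ n)

-‿^ℚ : ∀ x n → (- x) ^ℚ n ≡ sgn n * x ^ℚ n
-‿^ℚ x zero    = sym (*-identityˡ 1ℚ)
-‿^ℚ x (suc n) = trans (cong (- x *_) (-‿^ℚ x n)) (regroup x (sgn n) (x ^ℚ n))
  where
  regroup : ∀ x s p → - x * (s * p) ≡ (- 1ℚ * s) * (x * p)
  regroup = solve-∀ ℚ-ring

sgn-+ : ∀ a b → sgn (a ℕ.+ b) ≡ sgn a * sgn b
sgn-+ = ^ℚ-distribˡ-+-* (- 1ℚ)

⊛-congʳ : ∀ (a : Series) {b c : Series} → (∀ i → b i ≡ c i) → ∀ n → (a ⊛ b) n ≡ (a ⊛ c) n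
⊛-congʳ a b≡c n = sumTo-cong n (λ i _ → cong (a i *_) (b≡c (n ∸ i)))

⊛-identityʳ : ∀ (a : Series) n → (a ⊛ oneS) n ≡ a n
⊛-identityʳ a zero    = *-identityʳ (a 0)
⊛-identityʳ a (suc n) = begin
  sumTo n (λ i → a i * oneS (suc n ∸ i)) + a (suc n) * oneS (suc n ∸ suc n)
    ≡⟨ cong₂ _+_ (sumTo-zero n _ off-diagonal) (cong (λ j → a (suc n) * oneS j) (ℕₚ.n∸n≡0 n)) ⟩
  0ℚ + a (suc n) * 1ℚ
    ≡⟨ trans (+-identityˡ _) (*-identityʳ (a (suc n))) ⟩
  a (suc n) ∎
  where
  off-diagonal : ∀ i → i ℕ.≤ n → a i * oneS (suc n ∸ i) ≡ 0ℚ
  off-diagonal i i≤n = trans (cong (λ j → a i * oneS j) (ℕₚ.+-∸-assoc 1 i≤n)) (*-zeroʳ (a i))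

expS-zero : ∀ n → expS 0ℚ n ≡ oneS n
expS-zero zero    = refl
expS-zero (suc n) = trans (cong (_* inv! (suc n)) (*-zeroˡ (0ℚ ^ℚ n))) (*-zeroˡ (inv! (suc n)))

dilateS : ℚ → Series → Series
dilateS c a n = c ^ℚ n * a n

⊛-scale-dilate : ∀ s r c {a b a′ b′ : Series} →
  (∀ n → a′ n ≡ scaleS s (dilateS c a) n) → (∀ n → b′ n ≡ scaleS r (dilateS c b) n) →
  ∀ n → (a′ ⊛ b′) n ≡ scaleS (s * r) (dilateS c (a ⊛ b)) n
⊛-scale-dilate s r c {a} {b} {a′} {b′} a′≡ b′≡ n = begin
  sumTo n (λ i → a′ i * b′ (n ∸ i))
    ≡⟨ sumTo-cong n term ⟩
  sumTo n (λ i → (s * r) * (c ^ℚ n * (a i * b (n ∸ i))))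
    ≡⟨ sym (*-distribˡ-sumTo n (s * r) _) ⟩
  (s * r) * sumTo n (λ i → c ^ℚ n * (a i * b (n ∸ i)))
    ≡⟨ cong ((s * r) *_) (sym (*-distribˡ-sumTo n (c ^ℚ n) _)) ⟩
  (s * r) * (c ^ℚ n * (a ⊛ b) n) ∎
  where
  regroup : ∀ s ci a r cj b → (s * (ci * a)) * (r * (cj * b)) ≡ (s * r) * ((ci * cj) * (a * b))
  regroup = solve-∀ ℚ-ring
  term : ∀ i → i ℕ.≤ n → a′ i * b′ (n ∸ i) ≡ (s * r) * (c ^ℚ n * (a i * b (n ∸ i)))
  term i i≤n = begin
    a′ i * b′ (n ∸ i)
      ≡⟨ cong₂ _*_ (a′≡ i) (b′≡ (n ∸ i)) ⟩
    (s * (c ^ℚ i * a i)) * (r * (c ^ℚ (n ∸ i) * b (n ∸ i)))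
      ≡⟨ regroup s (c ^ℚ i) (a i) r (c ^ℚ (n ∸ i)) (b (n ∸ i)) ⟩
    (s * r) * ((c ^ℚ i * c ^ℚ (n ∸ i)) * (a i * b (n ∸ i)))
      ≡⟨ cong (λ x → (s * r) * (x * (a i * b (n ∸ i)))) (sym (^ℚ-distribˡ-+-* c i (n ∸ i))) ⟩
    (s * r) * (c ^ℚ (i ℕ.+ (n ∸ i)) * (a i * b (n ∸ i)))
      ≡⟨ cong (λ j → (s * r) * (c ^ℚ j * (a i * b (n ∸ i)))) (ℕₚ.m+[n∸m]≡n i≤n) ⟩
    (s * r) * (c ^ℚ n * (a i * b (n ∸ i))) ∎

powS-scale-dilate : ∀ s c {a a′ : Series} → (∀ n → a′ n ≡ scaleS s (dilateS c a) n) →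
  ∀ l n → powS a′ l n ≡ scaleS (s ^ℚ l) (dilateS c (powS a l)) n
powS-scale-dilate s c a′≡ zero    zero    = refl
powS-scale-dilate s c a′≡ zero    (suc n) =
  sym (trans (*-identityˡ _) (*-zeroʳ (c ^ℚ suc n)))
powS-scale-dilate s c a′≡ (suc l) =
  ⊛-scale-dilate s (s ^ℚ l) c a′≡ (powS-scale-dilate s c a′≡ l)

expMinusOne : Series
expMinusOne = expS 1ℚ ⊕ scaleS (- 1ℚ) oneS

oneMinusExpM2≡-expMinusOne[-2t] : ∀ n → oneMinusExpM2 n ≡ scaleS (- 1ℚ) (dilateS (- ι 2) expMinusOne) n
oneMinusExpM2≡-expMinusOne[-2t] zero    = refl
oneMinusExpM2≡-expMinusOne[-2t] (suc n) = begin
  0ℚ + - 1ℚ * (w * inv! (suc n))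
    ≡⟨ regroup w (inv! (suc n)) ⟩
  - 1ℚ * (w * (1ℚ * inv! (suc n) + - 1ℚ * 0ℚ))
    ≡⟨ cong (λ x → - 1ℚ * (w * (x * inv! (suc n) + - 1ℚ * 0ℚ))) (sym (^ℚ-zeroˡ (suc n))) ⟩
  - 1ℚ * (w * (1ℚ ^ℚ suc n * inv! (suc n) + - 1ℚ * 0ℚ)) ∎
  where
  w : ℚ
  w = (- ι 2) ^ℚ suc n
  regroup : ∀ x y → 0ℚ + - 1ℚ * (x * y) ≡ - 1ℚ * (x * (1ℚ * y + - 1ℚ * 0ℚ))
  regroup = solve-∀ ℚ-ring

powS-oneMinusExpM2 : ∀ l n →
  powS oneMinusExpM2 l n ≡ sgn (n ℕ.+ l) * (ι 2 ^ℚ n * powS expMinusOne l n)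
powS-oneMinusExpM2 l n = begin
  powS oneMinusExpM2 l n
    ≡⟨ powS-scale-dilate (- 1ℚ) (- ι 2) oneMinusExpM2≡-expMinusOne[-2t] l n ⟩
  sgn l * ((- ι 2) ^ℚ n * V)
    ≡⟨ cong (λ x → sgn l * (x * V)) (-‿^ℚ (ι 2) n) ⟩
  sgn l * ((sgn n * ι 2 ^ℚ n) * V)
    ≡⟨ regroup (sgn l) (sgn n) (ι 2 ^ℚ n) V ⟩
  (sgn n * sgn l) * (ι 2 ^ℚ n * V)
    ≡⟨ cong (_* (ι 2 ^ℚ n * V)) (sym (sgn-+ n l)) ⟩
  sgn (n ℕ.+ l) * (ι 2 ^ℚ n * V) ∎
  where
  V : ℚ
  V = powS expMinusOne l n
  regroup : ∀ a b x y → a * ((b * x) * y) ≡ (b * a) * (x * y)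
  regroup = solve-∀ ℚ-ring

ι-toℚᵘ : ∀ a → toℚᵘ (ι a) ℚᵘ.≃ ℚᵘ.mkℚᵘ (ℤ.+ a) 0
ι-toℚᵘ a = toℚᵘ-fromℚᵘ (ℚᵘ.mkℚᵘ (ℤ.+ a) 0)

ι-homo-* : ∀ a b → ι (a ℕ.* b) ≡ ι a * ι b
ι-homo-* a b = toℚᵘ-injective
  (ℚᵘₚ.≃-trans (ι-toℚᵘ (a ℕ.* b))
  (ℚᵘₚ.≃-trans (ℚᵘ.*≡* (cong (ℤ._* ℤ.+ 1) (ℤₚ.pos-* a b)))
  (ℚᵘₚ.≃-sym (ℚᵘₚ.≃-trans (toℚᵘ-homo-* (ι a) (ι b))
                          (ℚᵘₚ.*-cong (ι-toℚᵘ a) (ι-toℚᵘ b))))))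

1/n*ι[n]≡1 : ∀ n .{{_ : ℕ.NonZero n}} → (ℤ.+ 1 / n) * ι n ≡ 1ℚ
1/n*ι[n]≡1 (suc n) = toℚᵘ-injective
  (ℚᵘₚ.≃-trans (toℚᵘ-homo-* (ℤ.+ 1 / suc n) (ι (suc n)))
  (ℚᵘₚ.≃-trans (ℚᵘₚ.*-cong (toℚᵘ-fromℚᵘ (ℚᵘ.mkℚᵘ (ℤ.+ 1) n)) (ι-toℚᵘ (suc n)))
               (ℚᵘ.*≡* numerators)))
  where
  numerators : ℤ.+ 1 ℤ.* ℤ.+ suc n ℤ.* ℤ.+ 1 ≡ ℤ.+ 1 ℤ.* ℤ.+ (suc n ℕ.* 1)
  numerators = cong (λ x → ℤ.+ suc x)
    (trans (cong (ℕ._* 1) (ℕₚ.+-identityʳ n)) (sym (ℕₚ.+-identityʳ (n ℕ.* 1))))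

ι[nCm]*ι[m!]*ι[[n∸m]!]≡ι[n!] : ∀ {n m} → m ℕ.≤ n → ι (n C m) * (ι (m !) * ι ((n ∸ m) !)) ≡ ι (n !)
ι[nCm]*ι[m!]*ι[[n∸m]!]≡ι[n!] {n} {m} m≤n = begin
  ι (n C m) * (ι (m !) * ι ((n ∸ m) !))  ≡⟨ cong (ι (n C m) *_) (sym (ι-homo-* (m !) ((n ∸ m) !))) ⟩
  ι (n C m) * ι (m ! ℕ.* (n ∸ m) !)      ≡⟨ sym (ι-homo-* (n C m) _) ⟩
  ι ((n C m) ℕ.* (m ! ℕ.* (n ∸ m) !))    ≡⟨ cong ι nCm*m!*[n∸m]!≡n! ⟩
  ι (n !)                                ∎
  where
  nCm*m!*[n∸m]!≡n! : (n C m) ℕ.* (m ! ℕ.* (n ∸ m) !) ≡ n !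
  nCm*m!*[n∸m]!≡n! = trans (cong (ℕ._* (m ! ℕ.* (n ∸ m) !)) (nCk≡n!/k![n-k]! m≤n))
    (m/n*n≡m {{ℕₚ._!*_!≢0 m (n ∸ m)}} (k![n∸k]!∣n! m≤n))

ι[n!]*powS-expMinusOne≡ι[l!]*S2 : ∀ n l → ι (n !) * powS expMinusOne l n ≡ ι (l !) * S2 n l
ι[n!]*powS-expMinusOne≡ι[l!]*S2 n l = begin
  ι (n !) * V                             ≡⟨ sym (*-identityˡ _) ⟩
  1ℚ * (ι (n !) * V)                      ≡⟨ cong (_* (ι (n !) * V)) (sym (1/n*ι[n]≡1 (l !) {{l ℕₚ.!≢0}})) ⟩
  (inv! l * ι (l !)) * (ι (n !) * V)      ≡⟨ regroup (inv! l) (ι (l !)) (ι (n !)) V ⟩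
  ι (l !) * (ι (n !) * (inv! l * V))      ∎
  where
  V : ℚ
  V = powS expMinusOne l n
  regroup : ∀ a b c v → (a * b) * (c * v) ≡ b * (c * (a * v))
  regroup = solve-∀ ℚ-ring

invSuc[m]*ι[[1+m]!]≡ι[m!] : ∀ m → invSuc m * ι (suc m !) ≡ ι (m !)
invSuc[m]*ι[[1+m]!]≡ι[m!] m = begin
  invSuc m * ι (suc m ℕ.* m !)            ≡⟨ cong (invSuc m *_) (ι-homo-* (suc m) (m !)) ⟩
  invSuc m * (ι (suc m) * ι (m !))        ≡⟨ sym (*-assoc (invSuc m) (ι (suc m)) (ι (m !))) ⟩
  (invSuc m * ι (suc m)) * ι (m !)        ≡⟨ cong (_* ι (m !)) (1/n*ι[n]≡1 (suc m)) ⟩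
  1ℚ * ι (m !)                            ≡⟨ *-identityˡ (ι (m !)) ⟩
  ι (m !)                                 ∎

eulerStirlingTerm : ℕ → ℤ → ℕ → ℕ → ℚ
eulerStirlingTerm n k m l = ι (n C m) * (ι 2 ^ℚ m * (sgn (m ℕ.+ 1 ℕ.+ l) * (ι (l !)
  * (invPow (l ∸ 1) k * (invSuc m * (S2 (suc m) l * euler (n ∸ m)))))))

coefficient-identity : ∀ n m k l → m ℕ.≤ n →
  ι (n !) * ((invPow (l ∸ 1) k * powS oneMinusExpM2 l (suc m)) * invExpPlusOne (n ∸ m))
  ≡ eulerStirlingTerm n k m l
coefficient-identity n m k l m≤n = begin
  ι (n !) * ((P * powS oneMinusExpM2 l (suc m)) * I)
    ≡⟨ cong₂ (λ a u → a * ((P * u) * I)) (sym (ι[nCm]*ι[m!]*ι[[n∸m]!]≡ι[n!] m≤n)) coefficient-of-u^l ⟩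
  (B * (ι (m !) * ι ((n ∸ m) !))) * ((P * (σ * ((ι 2 * ι 2 ^ℚ m) * V))) * I)
    ≡⟨ regroup₁ B (ι (m !)) (ι ((n ∸ m) !)) P σ (ι 2) (ι 2 ^ℚ m) V I ⟩
  B * (ι 2 ^ℚ m * (σ * (P * ((ι (m !) * V) * euler (n ∸ m)))))
    ≡⟨ cong (λ x → B * (ι 2 ^ℚ m * (σ * (P * (x * euler (n ∸ m)))))) m!*V≡invSuc*l!*S2 ⟩
  B * (ι 2 ^ℚ m * (σ * (P * ((invSuc m * (ι (l !) * S)) * euler (n ∸ m)))))
    ≡⟨ regroup₂ B (ι 2 ^ℚ m) σ P (invSuc m) (ι (l !)) S (euler (n ∸ m)) ⟩
  B * (ι 2 ^ℚ m * (σ * (ι (l !) * (P * (invSuc m * (S * euler (n ∸ m))))))) ∎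
  where
  B P I V S σ : ℚ
  B = ι (n C m)
  P = invPow (l ∸ 1) k
  I = invExpPlusOne (n ∸ m)
  V = powS expMinusOne l (suc m)
  S = S2 (suc m) l
  σ = sgn (m ℕ.+ 1 ℕ.+ l)
  coefficient-of-u^l : powS oneMinusExpM2 l (suc m) ≡ σ * (ι 2 ^ℚ suc m * V)
  coefficient-of-u^l = trans (powS-oneMinusExpM2 l (suc m))
    (cong (λ j → sgn (j ℕ.+ l) * (ι 2 ^ℚ suc m * V)) (ℕₚ.+-comm 1 m))
  m!*V≡invSuc*l!*S2 : ι (m !) * V ≡ invSuc m * (ι (l !) * S)
  m!*V≡invSuc*l!*S2 = begin
    ι (m !) * V                        ≡⟨ cong (_* V) (sym (invSuc[m]*ι[[1+m]!]≡ι[m!] m)) ⟩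
    (invSuc m * ι (suc m !)) * V       ≡⟨ *-assoc (invSuc m) (ι (suc m !)) V ⟩
    invSuc m * (ι (suc m !) * V)       ≡⟨ cong (invSuc m *_) (ι[n!]*powS-expMinusOne≡ι[l!]*S2 (suc m) l) ⟩
    invSuc m * (ι (l !) * S)           ∎
  regroup₁ : ∀ c a b p s t q v i →
    (c * (a * b)) * ((p * (s * ((t * q) * v))) * i) ≡ c * (q * (s * (p * ((a * v) * (b * (t * i))))))
  regroup₁ = solve-∀ ℚ-ring
  regroup₂ : ∀ c q s p r f x e →
    c * (q * (s * (p * ((r * (f * x)) * e)))) ≡ c * (q * (s * (f * (p * (r * (x * e))))))
  regroup₂ = solve-∀ ℚ-ring

mainTheorem5 : (n : ℕ) (k : ℤ) →
    polyEuler n k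
      ≡ sumTo n (λ m → sum1To (suc m) (λ l →
          ι (n C m) * ((ι 2 ^ℚ m) * (sgn (m ℕ.+ 1 ℕ.+ l) * (ι (l ℕ.!)
            * (invPow (l ℕ.∸ 1) k * (invSuc m * (S2 (suc m) l * euler (n ℕ.∸ m)))))))))
mainTheorem5 n k = begin
  ι (n !) * ((Li ⊛ invExpPlusOne) ⊛ expS 0ℚ) n
    ≡⟨ cong (ι (n !) *_) (trans (⊛-congʳ (Li ⊛ invExpPlusOne) expS-zero n)
                                (⊛-identityʳ (Li ⊛ invExpPlusOne) n)) ⟩
  ι (n !) * sumTo n (λ m → Li m * invExpPlusOne (n ∸ m))
    ≡⟨ *-distribˡ-sumTo n (ι (n !)) _ ⟩
  sumTo n (λ m → ι (n !) * (Li m * invExpPlusOne (n ∸ m)))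
    ≡⟨ sumTo-cong n expand-Li ⟩
  sumTo n (λ m → sum1To (suc m) (eulerStirlingTerm n k m)) ∎
  where
  Li : Series
  Li = divT (LiS k oneMinusExpM2)
  expand-Li : ∀ m → m ℕ.≤ n →
    ι (n !) * (Li m * invExpPlusOne (n ∸ m)) ≡ sum1To (suc m) (eulerStirlingTerm n k m)
  expand-Li m m≤n = trans (cong (ι (n !) *_) (*-distribʳ-sum1To (suc m) (invExpPlusOne (n ∸ m)) _))
    (trans (*-distribˡ-sum1To (suc m) (ι (n !)) _)
      (sum1To-cong (suc m) (λ l → coefficient-identity n m k l m≤n)))
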